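{- Let $(W,S)$ be a Coxeter system with $k:=|S|<\infty$, let $L^W$ be a weak Lehmer code for $(W,S)$ and let $L\in L^W$. Let $\Pr(L)$ be the set of $L$-principal elements of $W$. Then $(\Pr(L),\leq)$, with the induced Bruhat order, is a meet-semilattice, and, as posets, $(\Pr(L),\leq)\simeq(\{L(w): w\in\Pr(L)\},\leq)$, where the latter set carries the componentwise order of $\mathbb{N}^k$.
   Context: $\mathbb{N}=\{0,1,2,\ldots\}$; $\mathbb{N}^k$ is ordered componentwise with rank function $\rho(x)=\sum_i x_i$; a multicomplex is an order ideal of $\mathbb{N}^k$. $\ell$ is the Coxeter length and $\leq$ the Bruhat order on $W$; $\mathrm{Aut}(W,\leq)$ is the group of poset automorphisms of $(W,\leq)$. A finite set $\{L_1,\ldots,L_h\}$ is a weak Lehmer code for $(W,S)$ if: (1) each $L_i:W\to\mathbb{N}^k$ is injective and rank-preserving ($\rho(L_i(w))=\ell(w)$); (2) for every $w\in W$ and $i$, if $\{L_i(v): v\leq w\}$ has exactly one maximal element then $\{L_i(v):v\leq w\}$ is a multicomplex; (3) for every $w\in W$ there exist $i$ and $\phi\in\mathrm{Aut}(W,\leq)$ such that $\{(L_i\circ\phi)(v): v\leq w\}$ is a multicomplex. For $L\in L^W$, an element $w\in W$ is $L$-principal if the set $\{L(v):v\leq w\}$ has exactly one maximal element with respect to the componentwise order. -}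

module Defs where

open import Data.Nat using (ℕ; zero; suc; _≤_; _<_)
open import Data.Fin using (Fin)
open import Data.List using (List; []; _∷_; _++_; length; reverse; concat; replicate)
open import Data.Vec using (Vec)
open import Data.Vec.Relation.Binary.Pointwise.Inductive using (Pointwise)
open import Data.Product using (Σ; ∃; _×_; _,_)
open import Relation.Binary.PropositionalEquality using (_≡_; _≢_)
open import Function using (_∘_; _⇔_)

_≤ᶜ_ : {k : ℕ} → Vec ℕ k → Vec ℕ k → Set
_≤ᶜ_ = Pointwise _≤_

ρ : {k : ℕ} → Vec ℕ k → ℕ
ρ = Data.Vec.sum

IsMulticomplex : {k : ℕ} → (Vec ℕ k → Set) → Set
IsMulticomplex A = ∀ x y → y ≤ᶜ x → A x → A y

IsMaximal : {k : ℕ} → (Vec ℕ k → Set) → Vec ℕ k → Set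
IsMaximal A x = A x × (∀ y → A y → x ≤ᶜ y → y ≡ x)

HasUniqueMax : {k : ℕ} → (Vec ℕ k → Set) → Set
HasUniqueMax A = Σ _ λ x → IsMaximal A x × (∀ y → IsMaximal A y → y ≡ x)

-- Coxeter matrix on S = Fin k; m i j = 0 encodes m(s,t) = ∞
IsCoxeterMatrix : {k : ℕ} → (Fin k → Fin k → ℕ) → Set
IsCoxeterMatrix {k} m =
  (∀ i → m i i ≡ 1) × (∀ i j → m i j ≡ m j i) × (∀ i j → i ≢ j → m i j ≢ 1)

Word : ℕ → Set
Word k = List (Fin k)

module Coxeter {k : ℕ} (m : Fin k → Fin k → ℕ) where

  relator : Fin k → Fin k → Word k
  relator i j = concat (replicate (m i j) (i ∷ j ∷ []))

  -- equality in W = ⟨ S | (st)^{m(s,t)} = 1 ⟩ : the congruence on words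
  -- generated by the Coxeter relators (generators are involutions since m i i = 1)
  infix 4 _≈_
  data _≈_ : Word k → Word k → Set where
    ≈-refl  : ∀ {u} → u ≈ u
    ≈-sym   : ∀ {u v} → u ≈ v → v ≈ u
    ≈-trans : ∀ {u v w} → u ≈ v → v ≈ w → u ≈ w
    ≈-rel   : ∀ a b i j → m i j ≢ 0 → (a ++ relator i j ++ b) ≈ (a ++ b)

  IsLength : Word k → ℕ → Set
  IsLength w n = (Σ (Word k) λ u → u ≈ w × length u ≡ n)
               × (∀ u → u ≈ w → n ≤ length u)

  reflection : Word k → Fin k → Word k
  reflection v s = v ++ (s ∷ []) ++ reverse v

  data Bruhat : Word k → Word k → Set where
    br-refl : ∀ {u w} → u ≈ w → Bruhat u w
    br-step : ∀ {u x w a b} → Bruhat u x → (v : Word k) (s : Fin k) →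
              IsLength x a → IsLength (x ++ reflection v s) b → a < b →
              (x ++ reflection v s) ≈ w → Bruhat u w

  Code : Set
  Code = Word k → Vec ℕ k

  Below : Code → Word k → Vec ℕ k → Set
  Below L w x = Σ (Word k) λ v → Bruhat v w × L v ≡ x

  IsInjRank : Code → Set
  IsInjRank L = (∀ u v → u ≈ v → L u ≡ L v)
              × (∀ u v → L u ≡ L v → u ≈ v)
              × (∀ w n → IsLength w n → ρ (L w) ≡ n)

  IsBruhatAut : (Word k → Word k) → Set
  IsBruhatAut φ = (∀ u v → u ≈ v → φ u ≈ φ v)
                × (∀ u v → φ u ≈ φ v → u ≈ v)
                × (∀ w → Σ (Word k) λ u → φ u ≈ w)
                × (∀ u v → Bruhat u v ⇔ Bruhat (φ u) (φ v))

  Principal : Code → Word k → Set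
  Principal L w = HasUniqueMax (Below L w)

  IsWeakLehmerCode : {h : ℕ} → (Fin h → Code) → Set
  IsWeakLehmerCode Ls =
      (∀ i → IsInjRank (Ls i))
    × (∀ w i → Principal (Ls i) w → IsMulticomplex (Below (Ls i) w))
    × (∀ w → Σ _ λ i → Σ (Word k → Word k) λ φ →
                 IsBruhatAut φ × IsMulticomplex (Below (Ls i ∘ φ) w))

  PrMeetSemilattice : Code → Set
  PrMeetSemilattice L =
    ∀ u v → Principal L u → Principal L v →
      Σ (Word k) λ z → Principal L z × Bruhat z u × Bruhat z v
        × (∀ y → Principal L y → Bruhat y u → Bruhat y v → Bruhat y z)

  PrImage : Code → Vec ℕ k → Set
  PrImage L x = Σ (Word k) λ w → Principal L w × L w ≡ x

  PrPosetIso : Code → Set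
  PrPosetIso L =
    Σ (Word k → Vec ℕ k) λ f →
        (∀ u v → u ≈ v → f u ≡ f v)
      × (∀ w → Principal L w → PrImage L (f w))
      × (∀ u v → Principal L u → Principal L v → f u ≡ f v → u ≈ v)
      × (∀ x → PrImage L x → Σ (Word k) λ w → Principal L w × f w ≡ x)
      × (∀ u v → Principal L u → Principal L v → Bruhat u v ⇔ (f u ≤ᶜ f v))

open Coxeter public

{-# OPTIONS --safe #-}
module Submission where

open import Defs
open import Data.Nat using (ℕ; zero; suc; _≤_; _<_; _+_; _⊓_)
open import Data.Nat.Properties
  using (≤-refl; ≤-reflexive; module ≤-Reasoning; ≤-trans; ≤-antisym; _≤?_; _≟_; <⇒≱; ≤∧≢⇒<; <-≤-trans;
         +-suc; +-identityʳ; m≤n+m; +-mono-≤; +-monoˡ-≤; +-mono-<-≤; +-monoʳ-<;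
         m⊓n≤m; m⊓n≤n; ⊓-glb)
open import Data.Fin using (Fin)
open import Data.List using (_++_)
open import Data.Vec using (Vec; []; _∷_; zipWith)
open import Data.Vec.Properties using (≡-dec)
import Data.Vec.Relation.Binary.Pointwise.Inductive as Pointwise
open Pointwise using ([]; _∷_)
open import Data.Product using (Σ; _×_; _,_; proj₁; proj₂)
open import Function using (_∘_; _⇔_; mk⇔)
open import Relation.Nullary using (¬_; Dec; yes; no; contradiction)
open import Relation.Nullary.Decidable using (decidable-stable)
open import Relation.Binary.PropositionalEquality using (_≡_; _≢_; refl; sym; cong; subst)

-- If w is L-principal, the maximum of {L(v) : v ≤ w} can only be L(w): every
-- other L(v) has smaller rank ℓ(v) < ℓ(w).  Since ranks are bounded, every
-- element of this set lies below a maximal one, hence below L(w); together with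
-- the multicomplex axiom this gives u ≤ w ⇔ L(u) ≤ L(w) for principal w, i.e.
-- L is an order embedding of Pr(L) into ℕ^k.  Meets are then computed in ℕ^k:
-- the componentwise minimum of L(u) and L(v) lies in the multicomplex below L(u),
-- so it is L(z) for some z ≤ u, and z is principal with L(z) the largest
-- element below it.  Only axioms (1) and (2) of a weak Lehmer code are used.

private
  variable
    k : ℕ

≤ᶜ-refl : {x : Vec ℕ k} → x ≤ᶜ x
≤ᶜ-refl = Pointwise.refl ≤-refl

≤ᶜ-trans : {x y z : Vec ℕ k} → x ≤ᶜ y → y ≤ᶜ z → x ≤ᶜ z
≤ᶜ-trans = Pointwise.trans ≤-trans

≤ᶜ-antisym : {x y : Vec ℕ k} → x ≤ᶜ y → y ≤ᶜ x → x ≡ y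
≤ᶜ-antisym []             []             = refl
≤ᶜ-antisym (a≤b ∷ xs≤ys) (b≤a ∷ ys≤xs) with ≤-antisym a≤b b≤a | ≤ᶜ-antisym xs≤ys ys≤xs
... | refl | refl = refl

_≤ᶜ?_ : (x y : Vec ℕ k) → Dec (x ≤ᶜ y)
_≤ᶜ?_ = Pointwise.decidable _≤?_

_≟ᶜ_ : (x y : Vec ℕ k) → Dec (x ≡ y)
_≟ᶜ_ = ≡-dec _≟_

infixl 30 _⊓ᶜ_

_⊓ᶜ_ : Vec ℕ k → Vec ℕ k → Vec ℕ k
_⊓ᶜ_ = zipWith _⊓_

⊓ᶜ-lowerˡ : (x y : Vec ℕ k) → x ⊓ᶜ y ≤ᶜ x
⊓ᶜ-lowerˡ []       []       = []
⊓ᶜ-lowerˡ (a ∷ xs) (b ∷ ys) = m⊓n≤m a b ∷ ⊓ᶜ-lowerˡ xs ys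

⊓ᶜ-lowerʳ : (x y : Vec ℕ k) → x ⊓ᶜ y ≤ᶜ y
⊓ᶜ-lowerʳ []       []       = []
⊓ᶜ-lowerʳ (a ∷ xs) (b ∷ ys) = m⊓n≤n a b ∷ ⊓ᶜ-lowerʳ xs ys

⊓ᶜ-glb : {x y z : Vec ℕ k} → z ≤ᶜ x → z ≤ᶜ y → z ≤ᶜ x ⊓ᶜ y
⊓ᶜ-glb []             []             = []
⊓ᶜ-glb (c≤a ∷ zs≤xs) (c≤b ∷ zs≤ys) = ⊓-glb c≤a c≤b ∷ ⊓ᶜ-glb zs≤xs zs≤ys

ρ-mono : {x y : Vec ℕ k} → x ≤ᶜ y → ρ x ≤ ρ y
ρ-mono []             = ≤-refl
ρ-mono (a≤b ∷ xs≤ys) = +-mono-≤ a≤b (ρ-mono xs≤ys)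

ρ-strictMono : {x y : Vec ℕ k} → x ≤ᶜ y → x ≢ y → ρ x < ρ y
ρ-strictMono [] x≢y = contradiction refl x≢y
ρ-strictMono {x = a ∷ _} {y = b ∷ _} (a≤b ∷ xs≤ys) x≢y with a ≟ b
... | yes refl = +-monoʳ-< a (ρ-strictMono xs≤ys (x≢y ∘ cong (a ∷_)))
... | no a≢b   = +-mono-<-≤ (≤∧≢⇒< a≤b a≢b) (ρ-mono xs≤ys)

module _ {A : Vec ℕ k → Set} where

  maximumRank⇒IsMaximal : ∀ {x} → A x → (∀ y → A y → ρ y ≤ ρ x) → IsMaximal A x
  maximumRank⇒IsMaximal {x} Ax ρ≤ρx = Ax , x-maximal
    where
      x-maximal : ∀ y → A y → x ≤ᶜ y → y ≡ x
      x-maximal y Ay x≤y with y ≟ᶜ x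
      ... | yes y≡x = y≡x
      ... | no y≢x  = contradiction (ρ≤ρx y Ay) (<⇒≱ (ρ-strictMono x≤y (y≢x ∘ sym)))

  greatest⇒HasUniqueMax : ∀ {c} → A c → (∀ y → A y → y ≤ᶜ c) → HasUniqueMax A
  greatest⇒HasUniqueMax {c} Ac ≤c =
    c , (Ac , λ y Ay c≤y → ≤ᶜ-antisym (≤c y Ay) c≤y) ,
    λ y (Ay , y-maximal) → sym (y-maximal c Ac (≤c y Ay))

  module _ {B : ℕ} (ρ≤B : ∀ y → A y → ρ y ≤ B) where

    -- n bounds the number of strict ascents above x: ρ grows along them and stays ≤ B.
    ¬¬≤ᶜ-maximal : ∀ n x → A x → B < ρ x + n → ¬ ¬ Σ _ λ y → IsMaximal A y × x ≤ᶜ y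
    ¬¬≤ᶜ-maximal zero x Ax B<ρx _ =
      <⇒≱ (subst (B <_) (+-identityʳ (ρ x)) B<ρx) (ρ≤B x Ax)
    ¬¬≤ᶜ-maximal (suc n) x Ax B<ρx+1+n noMaximalAbove =
      noMaximalAbove (x , (Ax , x-maximal) , ≤ᶜ-refl)
      where
        x-maximal : ∀ y → A y → x ≤ᶜ y → y ≡ x
        x-maximal y Ay x≤y with y ≟ᶜ x
        ... | yes y≡x = y≡x
        ... | no y≢x  = contradiction noMaximalAboveY (¬¬≤ᶜ-maximal n y Ay B<ρy+n)
          where
            B<ρy+n : B < ρ y + n
            B<ρy+n = <-≤-trans B<ρx+1+n (subst (_≤ ρ y + n) (sym (+-suc (ρ x) n))
                       (+-monoˡ-≤ n (ρ-strictMono x≤y (y≢x ∘ sym))))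
            noMaximalAboveY : ¬ Σ _ λ z → IsMaximal A z × y ≤ᶜ z
            noMaximalAboveY (z , z-maximal , y≤z) = noMaximalAbove (z , z-maximal , ≤ᶜ-trans x≤y y≤z)

    HasUniqueMax⇒greatest : (max : HasUniqueMax A) → ∀ x → A x → x ≤ᶜ proj₁ max
    HasUniqueMax⇒greatest (M , _ , unique) x Ax =
      decidable-stable (x ≤ᶜ? M) λ x≰M →
        ¬¬≤ᶜ-maximal (suc B) x Ax (m≤n+m (suc B) (ρ x))
          λ (y , y-maximal , x≤y) → x≰M (subst (x ≤ᶜ_) (unique y y-maximal) x≤y)

module _ (m : Fin k → Fin k → ℕ) where

  Bruhat-refl : ∀ {w} → Bruhat m w w
  Bruhat-refl = br-refl ≈-refl

  Bruhat-respˡ-≈ : ∀ {u u′ w} → _≈_ m u u′ → Bruhat m u′ w → Bruhat m u w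
  Bruhat-respˡ-≈ u≈u′ (br-refl u′≈w)                 = br-refl (≈-trans u≈u′ u′≈w)
  Bruhat-respˡ-≈ u≈u′ (br-step u′≤x v s ℓx ℓxt lt e) = br-step (Bruhat-respˡ-≈ u≈u′ u′≤x) v s ℓx ℓxt lt e

  Bruhat-respʳ-≈ : ∀ {u w w′} → Bruhat m u w → _≈_ m w w′ → Bruhat m u w′
  Bruhat-respʳ-≈ (br-refl u≈w)                 w≈w′ = br-refl (≈-trans u≈w w≈w′)
  Bruhat-respʳ-≈ (br-step u≤x v s ℓx ℓxt lt e) w≈w′ = br-step u≤x v s ℓx ℓxt lt (≈-trans e w≈w′)

  Bruhat-trans : ∀ {u w y} → Bruhat m u w → Bruhat m w y → Bruhat m u y
  Bruhat-trans u≤w (br-refl w≈y)                 = Bruhat-respʳ-≈ u≤w w≈y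
  Bruhat-trans u≤w (br-step w≤x v s ℓx ℓxt lt e) = br-step (Bruhat-trans u≤w w≤x) v s ℓx ℓxt lt e

  module _ {L : Code m} (L-injRank : IsInjRank m L) where

    private
      L-resp-≈ = proj₁ L-injRank
      L-injective = proj₁ (proj₂ L-injRank)
      ρ∘L≡length = proj₂ (proj₂ L-injRank)

    -- ρ ∘ L is the Coxeter length, which is monotone along Bruhat chains.
    Bruhat⇒ρL≤ : ∀ {u w} → Bruhat m u w → ρ (L u) ≤ ρ (L w)
    Bruhat⇒ρL≤ (br-refl u≈w) = ≤-reflexive (cong ρ (L-resp-≈ _ _ u≈w))
    Bruhat⇒ρL≤ {u} {w} (br-step {x = x} {a = a} {b = b} u≤x v s ℓx ℓxt a<b xt≈w) = begin
      ρ (L u)                       ≤⟨ Bruhat⇒ρL≤ u≤x ⟩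
      ρ (L x)                       ≡⟨ ρ∘L≡length x a ℓx ⟩
      a                             <⟨ a<b ⟩
      b                             ≡⟨ ρ∘L≡length _ b ℓxt ⟨
      ρ (L (x ++ reflection m v s)) ≡⟨ cong ρ (L-resp-≈ _ _ xt≈w) ⟩
      ρ (L w)                       ∎
      where open ≤-Reasoning

    L∈Below : ∀ w → Below m L w (L w)
    L∈Below w = w , Bruhat-refl , refl

    Below⇒ρ≤ρL : ∀ {w y} → Below m L w y → ρ y ≤ ρ (L w)
    Below⇒ρ≤ρL (v , v≤w , refl) = Bruhat⇒ρL≤ v≤w

    L-IsMaximal-Below : ∀ w → IsMaximal (Below m L w) (L w)
    L-IsMaximal-Below w = maximumRank⇒IsMaximal (L∈Below w) (λ _ → Below⇒ρ≤ρL)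

    Principal⇒Below-≤ᶜ : ∀ {w x} → Principal m L w → Below m L w x → x ≤ᶜ L w
    Principal⇒Below-≤ᶜ {w} {x} principal@(_ , _ , unique) x∈Below =
      subst (x ≤ᶜ_) (sym (unique (L w) (L-IsMaximal-Below w)))
        (HasUniqueMax⇒greatest (λ _ → Below⇒ρ≤ρL) principal x x∈Below)

    Bruhat⇒≤ᶜ : ∀ {u w} → Principal m L w → Bruhat m u w → L u ≤ᶜ L w
    Bruhat⇒≤ᶜ {u} w-principal u≤w = Principal⇒Below-≤ᶜ w-principal (u , u≤w , refl)

    module _ (principal-multicomplex : ∀ w → Principal m L w → IsMulticomplex (Below m L w)) where

      ≤ᶜ⇒Bruhat : ∀ {u w} → Principal m L w → L u ≤ᶜ L w → Bruhat m u w
      ≤ᶜ⇒Bruhat {u} {w} w-principal Lu≤Lw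
        with principal-multicomplex w w-principal (L w) (L u) Lu≤Lw (L∈Below w)
      ... | u′ , u′≤w , Lu′≡Lu = Bruhat-respˡ-≈ (L-injective u u′ (sym Lu′≡Lu)) u′≤w

      Principal-Bruhat⇔≤ᶜ : ∀ u w → Principal m L u → Principal m L w →
                            Bruhat m u w ⇔ (L u ≤ᶜ L w)
      Principal-Bruhat⇔≤ᶜ u w _ w-principal = mk⇔ (Bruhat⇒≤ᶜ w-principal) (≤ᶜ⇒Bruhat w-principal)

      Principal-meetSemilattice : PrMeetSemilattice m L
      Principal-meetSemilattice u v u-principal v-principal =
        z , z-principal , z≤u , z≤v , λ y _ y≤u y≤v → ≤ᶜ⇒Bruhat z-principal (≤ᶜLz y≤u y≤v)
        where
          c = L u ⊓ᶜ L v
          c∈Below-u : Below m L u c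
          c∈Below-u = principal-multicomplex u u-principal (L u) c (⊓ᶜ-lowerˡ (L u) (L v)) (L∈Below u)
          z = proj₁ c∈Below-u
          z≤u = proj₁ (proj₂ c∈Below-u)
          Lz≡c = proj₂ (proj₂ c∈Below-u)
          z≤v : Bruhat m z v
          z≤v = ≤ᶜ⇒Bruhat v-principal (subst (_≤ᶜ L v) (sym Lz≡c) (⊓ᶜ-lowerʳ (L u) (L v)))
          ≤ᶜLz : ∀ {y} → Bruhat m y u → Bruhat m y v → L y ≤ᶜ L z
          ≤ᶜLz y≤u y≤v = subst (_ ≤ᶜ_) (sym Lz≡c)
                           (⊓ᶜ-glb (Bruhat⇒≤ᶜ u-principal y≤u) (Bruhat⇒≤ᶜ v-principal y≤v))
          z-principal : Principal m L z
          z-principal = greatest⇒HasUniqueMax (L∈Below z) λ where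
            _ (y , y≤z , refl) → ≤ᶜLz (Bruhat-trans y≤z z≤u) (Bruhat-trans y≤z z≤v)

      Principal-posetIso : PrPosetIso m L
      Principal-posetIso =
        L , L-resp-≈ , (λ w w-principal → w , w-principal , refl) , (λ u v _ _ → L-injective u v) ,
        (λ _ x∈PrImage → x∈PrImage) , Principal-Bruhat⇔≤ᶜ

mainTheorem3 : {k : ℕ} (m : Fin k → Fin k → ℕ) → IsCoxeterMatrix m →
    {h : ℕ} (Ls : Fin h → Code m) → IsWeakLehmerCode m Ls →
    (i : Fin h) → PrMeetSemilattice m (Ls i) × PrPosetIso m (Ls i)
mainTheorem3 m _ Ls (injRank , principal-multicomplex , _) i =
  Principal-meetSemilattice m (injRank i) (λ w → principal-multicomplex w i) ,
  Principal-posetIso m (injRank i) (λ w → principal-multicomplex w i)
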